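{- For every integer $n\ge 0$, there is an injection from $V_3(1,n)$ into $U_3(0,n)$.
   Context: Durfee symbol of a partition $\lambda$. Set $\lambda_k=0$ for $k>\ell(\lambda)$. Let $d=\max\{k:\lambda_k\ge k\}$, with $d=0$ for the empty partition. Then $$\alpha=(\lambda_1-d,\ldots,\lambda_d-d)',$$ the conjugate of the partition formed by the positive entries, and $$\beta=(\lambda_{d+1},\ldots,\lambda_{\ell(\lambda)}).$$ This is written $\lambda=(\alpha,\beta)_d$. By convention parts beyond the length are $0$. For a nonempty partition $\beta$, $s(\beta)$ is its smallest part. $V(1,n)$ is the set of partitions of $n$ with Durfee symbol $(\alpha,\beta)_d$ such that $\ell(\alpha)-\ell(\beta)\le -2$ and $\beta_1=d$. $V_3(1,n)$ is the subset of $V(1,n)$ where $\alpha_1=d$ and $s(\beta)\ge 2$. $U(0,n)$ is the set of partitions of $n$ with Durfee symbol $(\gamma,\delta)_{d'}$ such that $\ell(\gamma)-\ell(\delta)\le 0$ and $\gamma_1\le d'-1$. $U_3(0,n)$ is the subset of $U(0,n)$ where $\ell(\gamma)=\ell(\delta)$ and $\delta_1\le d'-1$. -}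

module Defs where

open import Data.Nat using (ℕ; zero; suc; _+_; _∸_; _≤_; _<_; _≥_; _⊓_; _≤?_)
open import Data.List using (List; []; _∷_; map; length; filter; drop; take; foldr; applyUpTo)
open import Data.Nat.ListAction using (sum)
open import Data.List.Relation.Unary.All using (All)
open import Data.List.Relation.Unary.Linked using (Linked)
open import Data.Product using (Σ; _×_; _,_; proj₁)
open import Relation.Binary.PropositionalEquality using (_≡_)
open import Relation.Nullary.Decidable using (yes; no)

record IsPartitionOf (n : ℕ) (λs : List ℕ) : Set where
  field
    decreasing : Linked _≥_ λs
    positive   : All (λ x → 1 ≤ x) λs
    sums       : sum λs ≡ n

-- first part, with the convention that a missing part is 0
first : List ℕ → ℕ
first []      = 0
first (x ∷ _) = x

-- smallest part s(β) of a (nonempty) partition; only used for nonempty β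
smallest : List ℕ → ℕ
smallest []       = 0
smallest (x ∷ xs) = foldr _⊓_ x xs

countGe : ℕ → List ℕ → ℕ
countGe j xs = length (filter (j ≤?_) xs)

-- conjugate of a partition μ (given largest part first): μ'_j = #{i : μ_i ≥ j}, j = 1..μ_1
conj : List ℕ → List ℕ
conj []       = []
conj (m ∷ ms) = applyUpTo (λ j → countGe (suc j) (m ∷ ms)) m

-- Durfee size d = max{k : λ_k ≥ k}: counts the initial indices i (1-based) with λ_i ≥ i
durfeeFrom : ℕ → List ℕ → ℕ
durfeeFrom i []       = 0
durfeeFrom i (x ∷ xs) with i ≤? x
... | yes _ = suc (durfeeFrom (suc i) xs)
... | no  _ = 0

durfee : List ℕ → ℕ
durfee λs = durfeeFrom 1 λs

-- α = (λ_1 - d, ..., λ_d - d)' with only positive entries kept before conjugating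
alpha : List ℕ → List ℕ
alpha λs = conj (filter (1 ≤?_) (map (λ x → x ∸ durfee λs) (take (durfee λs) λs)))

beta : List ℕ → List ℕ
beta λs = drop (durfee λs) λs

-- V(1,n): ℓ(α) - ℓ(β) ≤ -2 and β_1 = d
InV1 : List ℕ → Set
InV1 λs = (length (alpha λs) + 2 ≤ length (beta λs)) × (first (beta λs) ≡ durfee λs)

InV3 : List ℕ → Set
InV3 λs = InV1 λs × (first (alpha λs) ≡ durfee λs) × (2 ≤ smallest (beta λs))

-- U(0,n): ℓ(γ) - ℓ(δ) ≤ 0 and γ_1 ≤ d' - 1 (as integers, i.e. γ_1 + 1 ≤ d')
InU0 : List ℕ → Set
InU0 λs = (length (alpha λs) ≤ length (beta λs)) × (first (alpha λs) + 1 ≤ durfee λs)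

InU3 : List ℕ → Set
InU3 λs = InU0 λs × (length (alpha λs) ≡ length (beta λs)) × (first (beta λs) + 1 ≤ durfee λs)

V3 : ℕ → Set
V3 n = Σ (List ℕ) λ λs → IsPartitionOf n λs × InV3 λs

U3 : ℕ → Set
U3 n = Σ (List ℕ) λ λs → IsPartitionOf n λs × InU3 λs

InjectionV3U3 : ℕ → Set
InjectionV3U3 n = Σ (V3 n → U3 n) λ f →
  ∀ x y → proj₁ (f x) ≡ proj₁ (f y) → proj₁ x ≡ proj₁ y

-- A partition in V₃(1,n) with Durfee square d has Durfee symbol (d ∷ a, d ∷ b)_d, where all parts of
-- a and b are at most d, the parts of b are at least 2 and ℓ(a) + 2 ≤ ℓ(b). Reading a as padded by
-- zeros, let i be the first index with aᵢ < bᵢ and exchange the tails behind it, lowering the parts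
-- moved out of b by one and raising those moved out of a by one. The resulting γ and δ are partitions
-- with parts at most d, ℓ(γ) = ℓ(δ) and |γ| + |δ| = |a| + |b| − 1, so the partition with Durfee symbol
-- (γ, δ)_{d+1} has weight (d + 1)² + |γ| + |δ| = d² + (d + |a|) + (d + |b|) = n and lies in U₃(0,n).
-- The exchange is undone by locating the first index with γᵢ < δᵢ, and a partition is determined by
-- its Durfee symbol, so the map is injective.

module Submission where

open import Defs
open import Data.Nat using (ℕ; zero; suc; _+_; _*_; _∸_; _≤_; _<_; _≥_; _⊓_; _≤?_; _<?_; z≤n; s≤s; z<s; pred)
open import Data.Nat.Properties
open import Algebra.Properties.CommutativeSemigroup +-commutativeSemigroup
  using () renaming (x∙yz≈y∙xz to +-left-comm; interchange to +-interchange)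
open import Data.Nat.ListAction using (sum)
open import Data.Nat.ListAction.Properties using (sum-++)
open import Data.Nat.Tactic.RingSolver using (solve-∀)
open import Data.List using (List; []; _∷_; _++_; map; length; filter; take; drop; foldr; applyUpTo)
open import Data.List.Properties
  using (filter-accept; filter-reject; filter-all; length-map; length-take;
         length-applyUpTo; map-applyUpTo; take++drop≡id)
open import Data.List.Relation.Binary.Sublist.Propositional using (⊆-refl)
open import Data.List.Relation.Binary.Sublist.Propositional.Properties using (filter⁺; length-mono-≤)
open import Data.List.Relation.Unary.All as All using (All; []; _∷_)
import Data.List.Relation.Unary.All.Properties as All
import Data.List.Relation.Unary.AllPairs.Properties as AllPairs
open import Data.List.Relation.Unary.Linked as Linked using (Linked; []; [-]; _∷_)
open import Data.List.Relation.Unary.Linked.Properties as Linked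
  using (Linked⇒All; Linked⇒AllPairs; AllPairs⇒Linked)
open import Data.Product using (_×_; _,_; proj₁; proj₂; uncurry)
import Data.Product as Product
open import Data.Empty using (⊥-elim)
open import Function using (_∘_; flip)
open import Relation.Binary.PropositionalEquality
open import Relation.Binary.Definitions using (Transitive; tri<; tri≈; tri>)
open import Relation.Nullary using (yes; no; ¬_)

Decreasing : List ℕ → Set
Decreasing = Linked _≥_

≥-trans : Transitive _≥_
≥-trans = flip ≤-trans

≤-head : ∀ {xs} → Decreasing xs → All (_≤ first xs) xs
≤-head []  = []
≤-head [-] = ≤-refl ∷ []
≤-head dxs@(_ ∷ _) = Linked⇒All ≥-trans ≤-refl dxs

∷-decreasing : ∀ {x ys} → first ys ≤ x → Decreasing ys → Decreasing (x ∷ ys)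
∷-decreasing {ys = []}    _   _  = [-]
∷-decreasing {ys = _ ∷ _} y≤x dy = y≤x ∷ dy

++-decreasing : ∀ {xs ys} → Decreasing xs → All (first ys ≤_) xs → Decreasing ys →
                Decreasing (xs ++ ys)
++-decreasing []        []            dys = dys
++-decreasing [-]       (p ∷ [])      dys = ∷-decreasing p dys
++-decreasing (r ∷ dxs) (_ ∷ ps)      dys = r ∷ ++-decreasing dxs ps dys

take-decreasing : ∀ n {xs} → Decreasing xs → Decreasing (take n xs)
take-decreasing n = AllPairs⇒Linked ∘ AllPairs.take⁺ n ∘ Linked⇒AllPairs ≥-trans

drop-decreasing : ∀ n {xs} → Decreasing xs → Decreasing (drop n xs)
drop-decreasing n = AllPairs⇒Linked ∘ AllPairs.drop⁺ n ∘ Linked⇒AllPairs ≥-trans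

first-drop-≤ : ∀ {xs} → Decreasing xs → first (drop 1 xs) ≤ first xs
first-drop-≤ []        = z≤n
first-drop-≤ [-]       = z≤n
first-drop-≤ (y≤x ∷ _) = y≤x

first-nonempty : ∀ {xs} → 0 < first xs → 0 < length xs
first-nonempty {_ ∷ _} _ = z<s

nonempty-∷ : ∀ {xs} → 0 < length xs → xs ≡ first xs ∷ drop 1 xs
nonempty-∷ {_ ∷ _} _ = refl

first-All : ∀ {P : ℕ → Set} {xs} → P 0 → All P xs → P (first xs)
first-All p0 []      = p0
first-All _  (p ∷ _) = p

sum-first-drop : ∀ xs → sum xs ≡ first xs + sum (drop 1 xs)
sum-first-drop []      = refl
sum-first-drop (_ ∷ _) = refl

pred-< : ∀ {n} → 1 ≤ n → pred n < n
pred-< (s≤s _) = ≤-refl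

first-map-pred-≤ : ∀ xs → first (map pred xs) ≤ first xs
first-map-pred-≤ []      = z≤n
first-map-pred-≤ (_ ∷ _) = pred[n]≤n

map-suc-pred : ∀ {xs} → All (1 ≤_) xs → map suc (map pred xs) ≡ xs
map-suc-pred []             = refl
map-suc-pred (s≤s _ ∷ xs⁺) = cong (_ ∷_) (map-suc-pred xs⁺)

sum-map-+ : ∀ c xs → sum (map (c +_) xs) ≡ length xs * c + sum xs
sum-map-+ c []       = refl
sum-map-+ c (x ∷ xs) = trans (cong (c + x +_) (sum-map-+ c xs)) (+-interchange c x (length xs * c) (sum xs))

sum-filter-positive : ∀ xs → sum (filter (1 ≤?_) xs) ≡ sum xs
sum-filter-positive []       = refl
sum-filter-positive (zero ∷ xs)  = sum-filter-positive xs
sum-filter-positive (suc x ∷ xs) = cong (suc x +_) (sum-filter-positive xs)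

map-+-∸ : ∀ d xs → All (d ≤_) xs → map (d +_) (map (_∸ d) xs) ≡ xs
map-+-∸ d []       []         = refl
map-+-∸ d (x ∷ xs) (d≤x ∷ ps) = cong₂ _∷_ (m+[n∸m]≡n d≤x) (map-+-∸ d xs ps)

≤-smallest : ∀ {k} xs → k ≤ smallest xs → All (k ≤_) xs
≤-smallest []       _ = []
≤-smallest (x ∷ xs) k≤ = ≤-foldr-⊓ xs k≤
  where
  ≤-foldr-⊓ : ∀ {k} ys → k ≤ foldr _⊓_ x ys → All (k ≤_) (x ∷ ys)
  ≤-foldr-⊓ []       k≤x = k≤x ∷ []
  ≤-foldr-⊓ (y ∷ ys) k≤m with ≤-foldr-⊓ ys (≤-trans k≤m (m⊓n≤n y _))
  ... | k≤x ∷ k≤ys = k≤x ∷ ≤-trans k≤m (m⊓n≤m y _) ∷ k≤ys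

applyUpTo-cong : ∀ {f g : ℕ → ℕ} n → (∀ i → f i ≡ g i) → applyUpTo f n ≡ applyUpTo g n
applyUpTo-cong zero    eq = refl
applyUpTo-cong (suc n) eq = cong₂ _∷_ (eq 0) (applyUpTo-cong n (eq ∘ suc))

take-applyUpTo-++ : ∀ (f : ℕ → ℕ) n ys → take n (applyUpTo f n ++ ys) ≡ applyUpTo f n
take-applyUpTo-++ f zero    ys = refl
take-applyUpTo-++ f (suc n) ys = cong (f 0 ∷_) (take-applyUpTo-++ (f ∘ suc) n ys)

drop-applyUpTo-++ : ∀ (f : ℕ → ℕ) n ys → drop n (applyUpTo f n ++ ys) ≡ ys
drop-applyUpTo-++ f zero    ys = refl
drop-applyUpTo-++ f (suc n) ys = drop-applyUpTo-++ (f ∘ suc) n ys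

-- λ_{t+1}, with missing parts read as 0
nth : ℕ → List ℕ → ℕ
nth t       []       = 0
nth zero    (x ∷ _)  = x
nth (suc t) (_ ∷ xs) = nth t xs

nth-applyUpTo : ∀ (f : ℕ → ℕ) {n t} → t < n → nth t (applyUpTo f n) ≡ f t
nth-applyUpTo f {suc n} {zero}  _         = refl
nth-applyUpTo f {suc n} {suc t} (s≤s t<n) = nth-applyUpTo (f ∘ suc) t<n

nth-≥-length : ∀ t xs → length xs ≤ t → nth t xs ≡ 0
nth-≥-length t       []       _          = refl
nth-≥-length (suc t) (_ ∷ xs) (s≤s len≤t) = nth-≥-length t xs len≤t

-- Counting parts

countGe-accept : ∀ {j x} xs → j ≤ x → countGe j (x ∷ xs) ≡ suc (countGe j xs)
countGe-accept {j} xs j≤x = cong length (filter-accept (j ≤?_) {xs = xs} j≤x)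

countGe-reject : ∀ {j x} xs → ¬ j ≤ x → countGe j (x ∷ xs) ≡ countGe j xs
countGe-reject {j} xs j≰x = cong length (filter-reject (j ≤?_) {xs = xs} j≰x)

countGe-cong-∷ : ∀ {j xs ys} x → countGe j xs ≡ countGe j ys → countGe j (x ∷ xs) ≡ countGe j (x ∷ ys)
countGe-cong-∷ {j} {xs} {ys} x eq with j ≤? x
... | yes j≤x = trans (countGe-accept xs j≤x) (trans (cong suc eq) (sym (countGe-accept ys j≤x)))
... | no  j≰x = trans (countGe-reject xs j≰x) (trans eq (sym (countGe-reject ys j≰x)))

countGe-cancel-∷ : ∀ {j xs ys} x → countGe j (x ∷ xs) ≡ countGe j (x ∷ ys) → countGe j xs ≡ countGe j ys
countGe-cancel-∷ {j} {xs} {ys} x eq with j ≤? x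
... | yes j≤x = suc-injective (trans (sym (countGe-accept xs j≤x)) (trans eq (countGe-accept ys j≤x)))
... | no  j≰x = trans (sym (countGe-reject xs j≰x)) (trans eq (countGe-reject ys j≰x))

countGe-antitone : ∀ {i j} xs → i ≤ j → countGe j xs ≤ countGe i xs
countGe-antitone {i} {j} xs i≤j =
  length-mono-≤ (filter⁺ (j ≤?_) (i ≤?_) (λ { refl j≤x → ≤-trans i≤j j≤x }) (⊆-refl {x = xs}))

countGe-bounded : ∀ {d j} xs → All (_≤ d) xs → d < j → countGe j xs ≡ 0
countGe-bounded []       []          _   = refl
countGe-bounded (x ∷ xs) (x≤d ∷ xs≤d) d<j =
  trans (countGe-reject xs (λ j≤x → <⇒≱ d<j (≤-trans j≤x x≤d))) (countGe-bounded xs xs≤d d<j)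

countGe-1-positive : ∀ {xs} → All (1 ≤_) xs → countGe 1 xs ≡ length xs
countGe-1-positive ps = cong length (filter-all (1 ≤?_) ps)

countGe-filter-positive : ∀ t xs → countGe (suc t) (filter (1 ≤?_) xs) ≡ countGe (suc t) xs
countGe-filter-positive t []           = refl
countGe-filter-positive t (zero ∷ xs)  = countGe-filter-positive t xs
countGe-filter-positive t (suc x ∷ xs) =
  countGe-cong-∷ {xs = filter (1 ≤?_) xs} (suc x) (countGe-filter-positive t xs)

countGe-map-pred : ∀ i xs → countGe (suc (suc i)) xs ≡ countGe (suc i) (map pred xs)
countGe-map-pred i []           = refl
countGe-map-pred i (zero ∷ xs)  = countGe-map-pred i xs
countGe-map-pred i (suc x ∷ xs) with suc i ≤? x
... | yes i<x = trans (countGe-accept xs (s≤s i<x))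
                     (trans (cong suc (countGe-map-pred i xs)) (sym (countGe-accept (map pred xs) i<x)))
... | no  i≮x = trans (countGe-reject xs (i≮x ∘ ≤-pred))
                     (trans (countGe-map-pred i xs) (sym (countGe-reject (map pred xs) i≮x)))

countGe-1-+-sum-pred : ∀ xs → countGe 1 xs + sum (map pred xs) ≡ sum xs
countGe-1-+-sum-pred []           = refl
countGe-1-+-sum-pred (zero ∷ xs)  = countGe-1-+-sum-pred xs
countGe-1-+-sum-pred (suc x ∷ xs) = cong suc (begin
  countGe 1 xs + (x + sum (map pred xs)) ≡⟨ +-left-comm (countGe 1 xs) x _ ⟩
  x + (countGe 1 xs + sum (map pred xs)) ≡⟨ cong (x +_) (countGe-1-+-sum-pred xs) ⟩
  x + sum xs                             ∎)
  where open ≡-Reasoning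

-- Counting the cells of the Young diagram by columns instead of rows.
sum-countGe : ∀ D xs → All (_≤ D) xs → sum (applyUpTo (λ i → countGe (suc i) xs) D) ≡ sum xs
sum-countGe zero    xs xs≤0 = sym (sum-zero xs xs≤0)
  where
  sum-zero : ∀ ys → All (_≤ 0) ys → sum ys ≡ 0
  sum-zero []       []          = refl
  sum-zero (_ ∷ ys) (z≤n ∷ ps) = sum-zero ys ps
sum-countGe (suc D) xs xs≤D = begin
  countGe 1 xs + sum (applyUpTo (λ i → countGe (suc (suc i)) xs) D)
    ≡⟨ cong (λ ys → countGe 1 xs + sum ys) (applyUpTo-cong D (λ i → countGe-map-pred i xs)) ⟩
  countGe 1 xs + sum (applyUpTo (λ i → countGe (suc i) (map pred xs)) D)
    ≡⟨ cong (countGe 1 xs +_) (sum-countGe D (map pred xs) (All.map⁺ (All.map pred-mono-≤ xs≤D))) ⟩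
  countGe 1 xs + sum (map pred xs)
    ≡⟨ countGe-1-+-sum-pred xs ⟩
  sum xs ∎
  where open ≡-Reasoning

countGe-above-head : ∀ {x t xs} → Decreasing (x ∷ xs) → x ≤ t → countGe (suc t) (x ∷ xs) ≡ 0
countGe-above-head dxs x≤t = countGe-bounded _ (≤-head dxs) (s≤s x≤t)

countGe-below-head : ∀ {i} p → i < first p → 1 ≤ countGe (suc i) p
countGe-below-head (x ∷ xs) i<x = subst (1 ≤_) (sym (countGe-accept xs i<x)) (s≤s z≤n)

countGe-injective : ∀ {p q} → Decreasing p → Decreasing q → length p ≡ length q →
                    (∀ t → countGe (suc t) p ≡ countGe (suc t) q) → p ≡ q
countGe-injective {[]}    {[]}    _  _  _   _  = refl
countGe-injective {x ∷ p} {y ∷ q} dp dq len eq with <-cmp x y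
... | tri< (s≤s {n = t} x≤t) _ _ =
  ⊥-elim (0≢1+n (trans (sym (countGe-above-head dp x≤t))
                       (trans (eq t) (countGe-accept {suc t} q ≤-refl))))
... | tri> _ _ (s≤s {n = t} y≤t) =
  ⊥-elim (0≢1+n (trans (sym (countGe-above-head dq y≤t))
                       (trans (sym (eq t)) (countGe-accept {suc t} p ≤-refl))))
... | tri≈ _ refl _ =
  cong (x ∷_) (countGe-injective (Linked.tail dp) (Linked.tail dq) (suc-injective len)
                                 (λ t → countGe-cancel-∷ {suc t} x (eq t)))

-- Conjugation

conj-applyUpTo : ∀ p → conj p ≡ applyUpTo (λ j → countGe (suc j) p) (first p)
conj-applyUpTo []      = refl
conj-applyUpTo (_ ∷ _) = refl

length-conj : ∀ p → length (conj p) ≡ first p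
length-conj p = trans (cong length (conj-applyUpTo p)) (length-applyUpTo _ (first p))

first-conj : ∀ {p} → All (1 ≤_) p → first (conj p) ≡ length p
first-conj {[]}        _        = refl
first-conj {zero ∷ _}  (() ∷ _)
first-conj {suc _ ∷ _} ps       = countGe-1-positive ps

conj-decreasing : ∀ p → Decreasing (conj p)
conj-decreasing p = subst Decreasing (sym (conj-applyUpTo p))
  (Linked.applyUpTo⁺₂ _ (first p) (λ i → countGe-antitone p (n≤1+n (suc i))))

conj-positive : ∀ p → All (1 ≤_) (conj p)
conj-positive []       = []
conj-positive (m ∷ ms) = All.applyUpTo⁺₁ _ m (countGe-below-head (m ∷ ms))

sum-conj : ∀ {p} → Decreasing p → sum (conj p) ≡ sum p
sum-conj {p} dp = trans (cong sum (conj-applyUpTo p)) (sum-countGe (first p) p (≤-head dp))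

nth-conj : ∀ {p} → Decreasing p → ∀ t → nth t (conj p) ≡ countGe (suc t) p
nth-conj {p} dp t with t <? first p
... | yes t<p = trans (cong (nth t) (conj-applyUpTo p)) (nth-applyUpTo _ t<p)
... | no  t≮p = trans (nth-≥-length t (conj p) (≤-trans (≤-reflexive (length-conj p)) (≮⇒≥ t≮p)))
                      (sym (countGe-bounded p (≤-head dp) (s≤s (≮⇒≥ t≮p))))

conj-injective : ∀ {p q} → Decreasing p → Decreasing q → All (1 ≤_) p → All (1 ≤_) q →
                 conj p ≡ conj q → p ≡ q
conj-injective {p} {q} dp dq pp pq eq = countGe-injective dp dq lengths counts
  where
  counts : ∀ t → countGe (suc t) p ≡ countGe (suc t) q
  counts t = trans (sym (nth-conj dp t)) (trans (cong (nth t) eq) (nth-conj dq t))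
  lengths : length p ≡ length q
  lengths = trans (sym (countGe-1-positive pp)) (trans (counts 0) (countGe-1-positive pq))

filter-positive-applyUpTo : ∀ (f : ℕ → ℕ) {D h} → h ≤ D → (∀ {i} → i < h → 1 ≤ f i) →
                            (∀ {i} → h ≤ i → f i ≡ 0) → filter (1 ≤?_) (applyUpTo f D) ≡ applyUpTo f h
filter-positive-applyUpTo f {zero}  {zero}  _         _   _    = refl
filter-positive-applyUpTo f {suc D} {zero}  _         _   vanish =
  trans (filter-reject (1 ≤?_) {xs = applyUpTo (f ∘ suc) D} (λ 0<f0 → <⇒≢ 0<f0 (sym (vanish z≤n))))
        (filter-positive-applyUpTo (f ∘ suc) {D} z≤n (λ ()) (λ _ → vanish z≤n))
filter-positive-applyUpTo f {suc D} {suc h} (s≤s h≤D) pos vanish =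
  trans (filter-accept (1 ≤?_) {xs = applyUpTo (f ∘ suc) D} (pos z<s))
        (cong (f 0 ∷_) (filter-positive-applyUpTo (f ∘ suc) h≤D (pos ∘ s≤s) (vanish ∘ s≤s)))

filter-positive-columns : ∀ D {p} → Decreasing p → first p ≤ D →
                          filter (1 ≤?_) (applyUpTo (λ i → countGe (suc i) p) D) ≡ conj p
filter-positive-columns D {p} dp p₁≤D =
  trans (filter-positive-applyUpTo _ p₁≤D (countGe-below-head p)
                                   (λ p₁≤i → countGe-bounded p (≤-head dp) (s≤s p₁≤i)))
        (sym (conj-applyUpTo p))

-- The Durfee square

durfeeFrom-accept : ∀ {i x} xs → i ≤ x → durfeeFrom i (x ∷ xs) ≡ suc (durfeeFrom (suc i) xs)
durfeeFrom-accept {i} {x} xs i≤x with i ≤? x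
... | yes _   = refl
... | no  i≰x = ⊥-elim (i≰x i≤x)

durfeeFrom-reject : ∀ {i x} xs → ¬ i ≤ x → durfeeFrom i (x ∷ xs) ≡ 0
durfeeFrom-reject {i} {x} xs i≰x with i ≤? x
... | yes i≤x = ⊥-elim (i≰x i≤x)
... | no  _   = refl

durfeeFrom-≤-length : ∀ i xs → durfeeFrom i xs ≤ length xs
durfeeFrom-≤-length i []       = z≤n
durfeeFrom-≤-length i (x ∷ xs) with i ≤? x
... | yes _ = s≤s (durfeeFrom-≤-length (suc i) xs)
... | no  _ = z≤n

durfeeFrom-head : ∀ {i x} xs → Decreasing (x ∷ xs) → i ≤ x → i + durfeeFrom (suc i) xs ≤ x
durfeeFrom-head {i} {x} []       _           i≤x = subst (_≤ x) (sym (+-identityʳ i)) i≤x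
durfeeFrom-head {i} {x} (y ∷ ys) (y≤x ∷ dys) i≤x with suc i ≤? y
... | yes i<y = subst (_≤ x) (sym (+-suc i _)) (≤-trans (durfeeFrom-head ys dys i<y) y≤x)
... | no  _   = subst (_≤ x) (sym (+-identityʳ i)) i≤x

-- i + D − 1 ≤ x, stated with suc x to avoid truncated subtraction.
durfeeFrom-rows : ∀ i xs → Decreasing xs →
                  All (λ x → i + durfeeFrom i xs ≤ suc x) (take (durfeeFrom i xs) xs)
durfeeFrom-rows i []       _   = []
durfeeFrom-rows i (x ∷ xs) dxs with i ≤? x
... | no  _   = []
... | yes i≤x =
  subst (_≤ suc x) (sym (+-suc i _)) (s≤s (durfeeFrom-head xs dxs i≤x))
  ∷ All.map (λ {z} → subst (_≤ suc z) (sym (+-suc i _))) (durfeeFrom-rows (suc i) xs (Linked.tail dxs))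

durfee-≤-rows : ∀ {l} → Decreasing l → All (durfee l ≤_) (take (durfee l) l)
durfee-≤-rows dl = All.map ≤-pred (durfeeFrom-rows 1 _ dl)

arms : List ℕ → List ℕ
arms l = map (_∸ durfee l) (take (durfee l) l)

length-arms : ∀ l → length (arms l) ≡ durfee l
length-arms l = trans (length-map _ (take (durfee l) l))
                      (trans (length-take (durfee l) l) (m≤n⇒m⊓n≡m (durfeeFrom-≤-length 1 l)))

arms-decreasing : ∀ {l} → Decreasing l → Decreasing (arms l)
arms-decreasing {l} dl = Linked.map⁺ (Linked.map (∸-monoˡ-≤ (durfee l)) (take-decreasing (durfee l) dl))

positiveArms-decreasing : ∀ {l} → Decreasing l → Decreasing (filter (1 ≤?_) (arms l))
positiveArms-decreasing dl = Linked.filter⁺ (1 ≤?_) ≥-trans (arms-decreasing dl)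

take-durfee : ∀ {l} → Decreasing l → take (durfee l) l ≡ map (durfee l +_) (arms l)
take-durfee {l} dl = sym (map-+-∸ (durfee l) (take (durfee l) l) (durfee-≤-rows dl))

countGe-arms : ∀ {l} → Decreasing l → ∀ t → countGe (suc t) (arms l) ≡ nth t (alpha l)
countGe-arms {l} dl t =
  trans (sym (countGe-filter-positive t (arms l))) (sym (nth-conj (positiveArms-decreasing dl) t))

sum-durfee : ∀ {l} → Decreasing l → sum l ≡ durfee l * durfee l + sum (alpha l) + sum (beta l)
sum-durfee {l} dl = begin
  sum l                                              ≡⟨ cong sum (sym (take++drop≡id d l)) ⟩
  sum (take d l ++ beta l)                           ≡⟨ sum-++ (take d l) (beta l) ⟩
  sum (take d l) + sum (beta l)                      ≡⟨ cong (λ xs → sum xs + sum (beta l)) (take-durfee dl) ⟩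
  sum (map (d +_) (arms l)) + sum (beta l)           ≡⟨ cong (_+ sum (beta l)) (sum-map-+ d (arms l)) ⟩
  length (arms l) * d + sum (arms l) + sum (beta l)  ≡⟨ cong₂ (λ m s → m * d + s + sum (beta l))
                                                              (length-arms l) (sym sum-alpha) ⟩
  d * d + sum (alpha l) + sum (beta l)               ∎
  where
  open ≡-Reasoning
  d = durfee l
  sum-alpha : sum (alpha l) ≡ sum (arms l)
  sum-alpha = trans (sum-conj (positiveArms-decreasing dl)) (sum-filter-positive (arms l))

durfeeSymbol-injective : ∀ {l₁ l₂} → Decreasing l₁ → Decreasing l₂ → durfee l₁ ≡ durfee l₂ →
                         alpha l₁ ≡ alpha l₂ → beta l₁ ≡ beta l₂ → l₁ ≡ l₂
durfeeSymbol-injective {l₁} {l₂} dl₁ dl₂ d≡ α≡ β≡ = begin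
  l₁                             ≡⟨ sym (take++drop≡id (durfee l₁) l₁) ⟩
  take (durfee l₁) l₁ ++ beta l₁ ≡⟨ cong₂ _++_ take≡ β≡ ⟩
  take (durfee l₂) l₂ ++ beta l₂ ≡⟨ take++drop≡id (durfee l₂) l₂ ⟩
  l₂                             ∎
  where
  open ≡-Reasoning
  arms≡ : arms l₁ ≡ arms l₂
  arms≡ = countGe-injective (arms-decreasing dl₁) (arms-decreasing dl₂)
    (trans (length-arms l₁) (trans d≡ (sym (length-arms l₂))))
    (λ t → trans (countGe-arms dl₁ t) (trans (cong (nth t) α≡) (sym (countGe-arms dl₂ t))))
  take≡ : take (durfee l₁) l₁ ≡ take (durfee l₂) l₂
  take≡ = trans (take-durfee dl₁) (trans (cong₂ (λ d xs → map (d +_) xs) d≡ arms≡) (sym (take-durfee dl₂)))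

-- Rebuilding a partition from a Durfee symbol

record BoundedPartition (d : ℕ) (xs : List ℕ) : Set where
  field
    decreasing : Decreasing xs
    positive   : All (1 ≤_) xs
    bounded    : All (_≤ d) xs

BoundedPartition-suc : ∀ {d xs} → BoundedPartition d xs → BoundedPartition (suc d) xs
BoundedPartition-suc bp = record
  { decreasing = decreasing ; positive = positive ; bounded = All.map m≤n⇒m≤1+n bounded }
  where open BoundedPartition bp

fromSymbol : ℕ → List ℕ → List ℕ → List ℕ
fromSymbol D g δ = applyUpTo (λ i → D + countGe (suc i) g) D ++ δ

durfeeFrom-applyUpTo-++ : ∀ (f : ℕ → ℕ) m i δ → (∀ {j} → j < m → i + j ≤ f j) →
                          durfeeFrom i (applyUpTo f m ++ δ) ≡ m + durfeeFrom (i + m) δ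
durfeeFrom-applyUpTo-++ f zero    i δ _   = cong (λ k → durfeeFrom k δ) (sym (+-identityʳ i))
durfeeFrom-applyUpTo-++ f (suc m) i δ big = begin
  durfeeFrom i (applyUpTo f (suc m) ++ δ)
    ≡⟨ durfeeFrom-accept (applyUpTo (f ∘ suc) m ++ δ) (subst (_≤ f 0) (+-identityʳ i) (big z<s)) ⟩
  suc (durfeeFrom (suc i) (applyUpTo (f ∘ suc) m ++ δ))
    ≡⟨ cong suc (durfeeFrom-applyUpTo-++ (f ∘ suc) m (suc i) δ
                   (λ {j} j<m → subst (_≤ f (suc j)) (+-suc i j) (big (s≤s j<m)))) ⟩
  suc (m + durfeeFrom (suc i + m) δ)
    ≡⟨ cong (λ k → suc (m + durfeeFrom k δ)) (sym (+-suc i m)) ⟩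
  suc m + durfeeFrom (i + suc m) δ ∎
  where open ≡-Reasoning

durfeeFrom-above : ∀ i δ → first δ < i → durfeeFrom i δ ≡ 0
durfeeFrom-above i []       _   = refl
durfeeFrom-above i (x ∷ xs) x<i = durfeeFrom-reject xs (<⇒≱ x<i)

durfee-fromSymbol : ∀ D g δ → first δ ≤ D → durfee (fromSymbol D g δ) ≡ D
durfee-fromSymbol D g δ δ₁≤D = begin
  durfee (fromSymbol D g δ)   ≡⟨ durfeeFrom-applyUpTo-++ _ D 1 δ (λ j<D → ≤-trans j<D (m≤m+n D _)) ⟩
  D + durfeeFrom (suc D) δ    ≡⟨ cong (D +_) (durfeeFrom-above (suc D) δ (s≤s δ₁≤D)) ⟩
  D + 0                       ≡⟨ +-identityʳ D ⟩
  D                           ∎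
  where open ≡-Reasoning

beta-fromSymbol : ∀ D g δ → first δ ≤ D → beta (fromSymbol D g δ) ≡ δ
beta-fromSymbol D g δ δ₁≤D = trans (cong (λ k → drop k (fromSymbol D g δ)) (durfee-fromSymbol D g δ δ₁≤D))
                                   (drop-applyUpTo-++ _ D δ)

alpha-fromSymbol : ∀ {D g δ} → Decreasing g → All (_≤ D) g → first δ ≤ D →
                   alpha (fromSymbol D g δ) ≡ conj (conj g)
alpha-fromSymbol {D} {g} {δ} dg g≤D δ₁≤D = begin
  alpha (fromSymbol D g δ)
    ≡⟨ cong (λ k → conj (filter (1 ≤?_) (map (_∸ k) (take k (fromSymbol D g δ)))))
            (durfee-fromSymbol D g δ δ₁≤D) ⟩
  conj (filter (1 ≤?_) (map (_∸ D) (take D (fromSymbol D g δ))))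
    ≡⟨ cong (λ xs → conj (filter (1 ≤?_) (map (_∸ D) xs))) (take-applyUpTo-++ _ D δ) ⟩
  conj (filter (1 ≤?_) (map (_∸ D) (applyUpTo (λ i → D + countGe (suc i) g) D)))
    ≡⟨ cong (conj ∘ filter (1 ≤?_)) (trans (map-applyUpTo _ (_∸ D) D)
                                           (applyUpTo-cong D (λ i → m+n∸m≡n D (countGe (suc i) g)))) ⟩
  conj (filter (1 ≤?_) (applyUpTo (λ i → countGe (suc i) g) D))
    ≡⟨ cong conj (filter-positive-columns D dg (first-All z≤n g≤D)) ⟩
  conj (conj g) ∎
  where open ≡-Reasoning

fromSymbol-isPartition : ∀ {D g δ} → Decreasing g → All (_≤ D) g → Decreasing δ → All (1 ≤_) δ →
                         first δ ≤ D → IsPartitionOf (D * D + sum g + sum δ) (fromSymbol D g δ)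
fromSymbol-isPartition {D} {g} {δ} dg g≤D dδ δ⁺ δ₁≤D = record
  { decreasing = ++-decreasing (Linked.applyUpTo⁺₂ rows D rows-decreasing)
                               (All.applyUpTo⁺₂ rows D δ₁≤rows) dδ
  ; positive   = All.++⁺ (All.applyUpTo⁺₁ rows D rows-positive) δ⁺
  ; sums       = trans (sum-++ (applyUpTo rows D) δ) (cong (_+ sum δ) sum-rows)
  }
  where
  open ≡-Reasoning
  rows : ℕ → ℕ
  rows i = D + countGe (suc i) g
  rows-decreasing : ∀ i → rows (suc i) ≤ rows i
  rows-decreasing i = +-monoʳ-≤ D (countGe-antitone g (n≤1+n (suc i)))
  δ₁≤rows : ∀ i → first δ ≤ rows i
  δ₁≤rows i = ≤-trans δ₁≤D (m≤m+n D _)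
  rows-positive : ∀ {i} → i < D → 1 ≤ rows i
  rows-positive i<D = ≤-trans (≤-trans (s≤s z≤n) i<D) (m≤m+n D _)
  columns : List ℕ
  columns = applyUpTo (λ i → countGe (suc i) g) D
  sum-rows : sum (applyUpTo rows D) ≡ D * D + sum g
  sum-rows = begin
    sum (applyUpTo rows D)            ≡⟨ cong sum (sym (map-applyUpTo _ (D +_) D)) ⟩
    sum (map (D +_) columns)          ≡⟨ sum-map-+ D columns ⟩
    length columns * D + sum columns  ≡⟨ cong₂ (λ m s → m * D + s) (length-applyUpTo _ D) (sum-countGe D g g≤D) ⟩
    D * D + sum g                     ∎

fromSymbol-injective : ∀ {D₁ D₂ g₁ g₂ δ₁ δ₂} →
                       BoundedPartition D₁ g₁ → first δ₁ ≤ D₁ → BoundedPartition D₂ g₂ → first δ₂ ≤ D₂ →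
                       fromSymbol D₁ g₁ δ₁ ≡ fromSymbol D₂ g₂ δ₂ → D₁ ≡ D₂ × (g₁ , δ₁) ≡ (g₂ , δ₂)
fromSymbol-injective {D₁} {D₂} {g₁} {g₂} {δ₁} {δ₂} bp₁ δ₁≤ bp₂ δ₂≤ eq = D≡ , cong₂ _,_ g≡ δ≡
  where
  module G₁ = BoundedPartition bp₁
  module G₂ = BoundedPartition bp₂
  D≡ : D₁ ≡ D₂
  D≡ = trans (sym (durfee-fromSymbol D₁ g₁ δ₁ δ₁≤))
             (trans (cong durfee eq) (durfee-fromSymbol D₂ g₂ δ₂ δ₂≤))
  δ≡ : δ₁ ≡ δ₂
  δ≡ = trans (sym (beta-fromSymbol D₁ g₁ δ₁ δ₁≤)) (trans (cong beta eq) (beta-fromSymbol D₂ g₂ δ₂ δ₂≤))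
  conj²≡ : conj (conj g₁) ≡ conj (conj g₂)
  conj²≡ = trans (sym (alpha-fromSymbol G₁.decreasing G₁.bounded δ₁≤))
                 (trans (cong alpha eq) (alpha-fromSymbol G₂.decreasing G₂.bounded δ₂≤))
  conj≡ : conj g₁ ≡ conj g₂
  conj≡ = conj-injective (conj-decreasing g₁) (conj-decreasing g₂)
                         (conj-positive g₁) (conj-positive g₂) conj²≡
  g≡ : g₁ ≡ g₂
  g≡ = conj-injective G₁.decreasing G₂.decreasing G₁.positive G₂.positive conj≡

+1-≤-suc : ∀ {m n} → m ≤ n → m + 1 ≤ suc n
+1-≤-suc {m} {n} m≤n = subst (_≤ suc n) (+-comm 1 m) (s≤s m≤n)

fromSymbol-InU3 : ∀ {d γ δ} → BoundedPartition d γ → BoundedPartition d δ → length γ ≡ length δ →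
                  InU3 (fromSymbol (suc d) γ δ)
fromSymbol-InU3 {d} {γ} {δ} bγ bδ len≡ = (≤-reflexive lengths , α₁+1≤D) , lengths , β₁+1≤D
  where
  module Γ = BoundedPartition bγ
  module Δ = BoundedPartition bδ
  μ : List ℕ
  μ = fromSymbol (suc d) γ δ
  δ₁≤d : first δ ≤ d
  δ₁≤d = first-All z≤n Δ.bounded
  α≡ : alpha μ ≡ conj (conj γ)
  α≡ = alpha-fromSymbol Γ.decreasing (All.map m≤n⇒m≤1+n Γ.bounded) (m≤n⇒m≤1+n δ₁≤d)
  β≡ : beta μ ≡ δ
  β≡ = beta-fromSymbol (suc d) γ δ (m≤n⇒m≤1+n δ₁≤d)
  D≡ : durfee μ ≡ suc d
  D≡ = durfee-fromSymbol (suc d) γ δ (m≤n⇒m≤1+n δ₁≤d)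
  lengths : length (alpha μ) ≡ length (beta μ)
  lengths = trans (cong length α≡) (trans (length-conj (conj γ))
                  (trans (first-conj Γ.positive) (trans len≡ (cong length (sym β≡)))))
  α₁≡γ₁ : first (alpha μ) ≡ first γ
  α₁≡γ₁ = trans (cong first α≡) (trans (first-conj (conj-positive γ)) (length-conj γ))
  α₁+1≤D : first (alpha μ) + 1 ≤ durfee μ
  α₁+1≤D = subst₂ (λ x D → x + 1 ≤ D) (sym α₁≡γ₁) (sym D≡) (+1-≤-suc (first-All z≤n Γ.bounded))
  β₁+1≤D : first (beta μ) + 1 ≤ durfee μ
  β₁+1≤D = subst₂ (λ x D → x + 1 ≤ D) (cong first (sym β≡)) (sym D≡) (+1-≤-suc δ₁≤d)

-- Exchanging tails

raisePad : ℕ → List ℕ → List ℕ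
raisePad zero    a = []
raisePad (suc k) a = suc (first a) ∷ raisePad k (drop 1 a)

length-raisePad : ∀ k a → length (raisePad k a) ≡ k
length-raisePad zero    a = refl
length-raisePad (suc k) a = cong suc (length-raisePad k (drop 1 a))

sum-raisePad : ∀ k a → length a ≤ k → sum (raisePad k a) ≡ k + sum a
sum-raisePad zero    []       _          = refl
sum-raisePad (suc k) []       _          = cong suc (sum-raisePad k [] z≤n)
sum-raisePad (suc k) (x ∷ a) (s≤s a≤k) =
  cong suc (trans (cong (x +_) (sum-raisePad k a a≤k)) (+-left-comm x k (sum a)))

raisePad-positive : ∀ k a → All (1 ≤_) (raisePad k a)
raisePad-positive zero    a = []
raisePad-positive (suc k) a = s≤s z≤n ∷ raisePad-positive k (drop 1 a)

raisePad-≤ : ∀ k {a} → Decreasing a → All (_≤ suc (first a)) (raisePad k a)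
raisePad-≤ zero    _  = []
raisePad-≤ (suc k) da =
  ≤-refl ∷ All.map (λ p → ≤-trans p (s≤s (first-drop-≤ da))) (raisePad-≤ k (drop-decreasing 1 da))

raisePad-decreasing : ∀ k {a} → Decreasing a → Decreasing (raisePad k a)
raisePad-decreasing zero    _  = []
raisePad-decreasing (suc k) da =
  ∷-decreasing (first-All z≤n (All.tail (raisePad-≤ (suc k) da)))
               (raisePad-decreasing k (drop-decreasing 1 da))

filter-positive-pred-raisePad : ∀ k {a} → All (1 ≤_) a → length a ≤ k →
                                filter (1 ≤?_) (map pred (raisePad k a)) ≡ a
filter-positive-pred-raisePad zero    []                 _          = refl
filter-positive-pred-raisePad (suc k) []                 _          = filter-positive-pred-raisePad k [] z≤n
filter-positive-pred-raisePad (suc k) {suc x ∷ a} (_ ∷ a⁺) (s≤s a≤k) =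
  cong (suc x ∷_) (filter-positive-pred-raisePad k a⁺ a≤k)

sum-map-pred : ∀ {xs} → All (1 ≤_) xs → length xs + sum (map pred xs) ≡ sum xs
sum-map-pred {xs} xs⁺ = trans (cong (_+ sum (map pred xs)) (sym (countGe-1-positive xs⁺)))
                              (countGe-1-+-sum-pred xs)

+-pair-step : ∀ {x y g e s t} → g + e + 1 ≡ s + t → x + g + (y + e) + 1 ≡ x + s + (y + t)
+-pair-step {x} {y} {g} {e} {s} {t} eq =
  trans (rearrange x y g e) (trans (cong (x + y +_) eq) (rearrange′ x y s t))
  where
  rearrange : ∀ x y g e → x + g + (y + e) + 1 ≡ x + y + (g + e + 1)
  rearrange = solve-∀
  rearrange′ : ∀ x y s t → x + y + (s + t) ≡ x + s + (y + t)
  rearrange′ = solve-∀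

-- For a padded by zeros and i the first index with aᵢ < bᵢ, swapTails sends (a, b) to
-- ((a₁, …, a_{i-1}, b_{i+1} − 1, …, b_m − 1), (b₁, …, bᵢ, aᵢ + 1, …, a_{m-1} + 1)).
exchange : List ℕ → ℕ → List ℕ → List ℕ × List ℕ
exchange a y b = map pred b , y ∷ raisePad (length b ∸ 1) a

swapTails : List ℕ → List ℕ → List ℕ × List ℕ
swapTails a []      = [] , []
swapTails a (y ∷ b) with first a <? y
... | yes _ = exchange a y b
... | no  _ = Product.map (first a ∷_) (y ∷_) (swapTails (drop 1 a) b)

unswapTails : List ℕ → List ℕ → List ℕ × List ℕ
unswapTails []      δ       = [] , δ
unswapTails (_ ∷ _) []      = [] , []
unswapTails (g ∷ γ) (y ∷ δ) with g <? y
... | yes _ = filter (1 ≤?_) (map pred δ) , y ∷ map suc (g ∷ γ)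
... | no  _ = Product.map (g ∷_) (y ∷_) (unswapTails γ δ)

record SwapInput (d : ℕ) (a b : List ℕ) : Set where
  field
    a-partition  : BoundedPartition d a
    b-decreasing : Decreasing b
    b-≥2         : All (2 ≤_) b
    b-bounded    : All (_≤ d) b
    longer       : length a + 2 ≤ length b

module _ {d : ℕ} where
  open SwapInput
  open BoundedPartition

  SwapInput-long : ∀ {a b} → SwapInput d a b → 2 ≤ length b
  SwapInput-long {a} inp = ≤-trans (m≤n+m 2 (length a)) (longer inp)

  SwapInput-shorter : ∀ {a y₁ y₂ b} → SwapInput d a (y₁ ∷ y₂ ∷ b) → length a ≤ length b
  SwapInput-shorter {a} {b = b} inp =
    +-cancelʳ-≤ 2 (length a) (length b) (≤-trans (longer inp) (≤-reflexive (+-comm 2 (length b))))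

  b-positive : ∀ {a b} → SwapInput d a b → All (1 ≤_) b
  b-positive inp = All.map <⇒≤ (b-≥2 inp)

  SwapInput-first : ∀ {a y b} → SwapInput d a (y ∷ b) → ¬ first a < y → 2 ≤ first a
  SwapInput-first inp a≮y = ≤-trans (All.head (b-≥2 inp)) (≮⇒≥ a≮y)

  SwapInput-step : ∀ {a y b} → SwapInput d a (y ∷ b) → ¬ first a < y → SwapInput d (drop 1 a) b
  SwapInput-step {[]}    inp a≮y with () ← SwapInput-first inp a≮y
  SwapInput-step {x ∷ a} inp _   = record
    { a-partition  = record { decreasing = Linked.tail (decreasing A)
                            ; positive   = All.tail (positive A)
                            ; bounded    = All.tail (bounded A) }
    ; b-decreasing = Linked.tail (b-decreasing inp)
    ; b-≥2         = All.tail (b-≥2 inp)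
    ; b-bounded    = All.tail (b-bounded inp)
    ; longer       = ≤-pred (longer inp)
    }
    where
    A : BoundedPartition d (x ∷ a)
    A = a-partition inp

  exchange-length : ∀ {a y b} → SwapInput d a (y ∷ b) →
                    length (proj₁ (exchange a y b)) ≡ length (proj₂ (exchange a y b))
  exchange-length {b = []}        inp with s≤s () ← SwapInput-long inp
  exchange-length {a} {b = _ ∷ b} _   = cong suc (trans (length-map pred b) (sym (length-raisePad (length b) a)))

  exchange-sum : ∀ {a y b} → SwapInput d a (y ∷ b) →
                 sum (proj₁ (exchange a y b)) + sum (proj₂ (exchange a y b)) + 1 ≡ sum a + sum (y ∷ b)
  exchange-sum {b = []}              inp with s≤s () ← SwapInput-long inp
  exchange-sum {a} {y} {b@(_ ∷ b′)} inp = begin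
    sum (map pred b) + (y + sum (raisePad (length b′) a)) + 1
      ≡⟨ cong (λ s → sum (map pred b) + (y + s) + 1) (sum-raisePad (length b′) a (SwapInput-shorter inp)) ⟩
    sum (map pred b) + (y + (length b′ + sum a)) + 1
      ≡⟨ rearrange (sum (map pred b)) y (length b′) (sum a) ⟩
    sum a + (y + (length b + sum (map pred b)))
      ≡⟨ cong (λ s → sum a + (y + s)) (sum-map-pred (All.tail (b-positive inp))) ⟩
    sum a + (y + sum b) ∎
    where
    open ≡-Reasoning
    rearrange : ∀ p y l s → p + (y + (l + s)) + 1 ≡ s + (y + (suc l + p))
    rearrange = solve-∀

  exchange-γ : ∀ {a y b} → SwapInput d a (y ∷ b) → BoundedPartition d (proj₁ (exchange a y b))
  exchange-γ inp = record
    { decreasing = Linked.map⁺ (Linked.map pred-mono-≤ (Linked.tail (b-decreasing inp)))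
    ; positive   = All.map⁺ (All.map pred-mono-≤ (All.tail (b-≥2 inp)))
    ; bounded    = All.map⁺ (All.map (≤-trans pred[n]≤n) (All.tail (b-bounded inp)))
    }

  exchange-δ : ∀ {a y b} → SwapInput d a (y ∷ b) → first a < y → BoundedPartition d (proj₂ (exchange a y b))
  exchange-δ {a} {y} {b} inp a<y = record
    { decreasing = ∷-decreasing (first-All z≤n pad≤y) (raisePad-decreasing k (decreasing (a-partition inp)))
    ; positive   = All.head (b-positive inp) ∷ raisePad-positive k a
    ; bounded    = All.head (b-bounded inp) ∷ All.map (λ p → ≤-trans p (All.head (b-bounded inp))) pad≤y
    }
    where
    k : ℕ
    k = length b ∸ 1
    pad≤y : All (_≤ y) (raisePad k a)
    pad≤y = All.map (λ p → ≤-trans p a<y) (raisePad-≤ k (decreasing (a-partition inp)))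

  unswapTails-exchange : ∀ {a y b} → SwapInput d a (y ∷ b) → uncurry unswapTails (exchange a y b) ≡ (a , y ∷ b)
  unswapTails-exchange {b = []} inp with s≤s () ← SwapInput-long inp
  unswapTails-exchange {a} {y} {b@(y₁ ∷ b′)} inp with pred y₁ <? y
  ... | yes _    = cong₂ _,_ (filter-positive-pred-raisePad (length b′) (positive (a-partition inp))
                                                           (SwapInput-shorter inp))
                             (cong (y ∷_) (map-suc-pred (All.tail (b-positive inp))))
  ... | no  y₁≮y = ⊥-elim (y₁≮y (≤-trans (pred-< (All.head (All.tail (b-positive inp))))
                                         (Linked.head (b-decreasing inp))))

  swapTails-length : ∀ {a b} → SwapInput d a b →
                     length (proj₁ (swapTails a b)) ≡ length (proj₂ (swapTails a b))
  swapTails-length {b = []}      _   = refl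
  swapTails-length {a} {y ∷ b} inp with first a <? y
  ... | yes _   = exchange-length inp
  ... | no  a≮y = cong suc (swapTails-length (SwapInput-step inp a≮y))

  swapTails-sum : ∀ {a b} → SwapInput d a b →
                  sum (proj₁ (swapTails a b)) + sum (proj₂ (swapTails a b)) + 1 ≡ sum a + sum b
  swapTails-sum {b = []}      inp with () ← SwapInput-long inp
  swapTails-sum {a} {y ∷ b} inp with first a <? y
  ... | yes _   = exchange-sum inp
  ... | no  a≮y = trans (+-pair-step {first a} {y} (swapTails-sum (SwapInput-step inp a≮y)))
                        (cong (_+ (y + sum b)) (sym (sum-first-drop a)))

  swapTails-first-≤ : ∀ {z} a b → first a ≤ z → first b ≤ z → Decreasing b → first (proj₁ (swapTails a b)) ≤ z
  swapTails-first-≤ a []      _   _   _  = z≤n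
  swapTails-first-≤ a (y ∷ b) a≤z y≤z db with first a <? y
  ... | yes _ = ≤-trans (first-map-pred-≤ b) (≤-trans (first-drop-≤ db) y≤z)
  ... | no  _ = a≤z

  swapTails-first-δ : ∀ a b → first (proj₂ (swapTails a b)) ≡ first b
  swapTails-first-δ a []      = refl
  swapTails-first-δ a (y ∷ b) with first a <? y
  ... | yes _ = refl
  ... | no  _ = refl

  swapTails-γ : ∀ {a b} → SwapInput d a b → BoundedPartition d (proj₁ (swapTails a b))
  swapTails-γ {b = []}      _   = record { decreasing = [] ; positive = [] ; bounded = [] }
  swapTails-γ {a} {y ∷ b} inp with first a <? y
  ... | yes _   = exchange-γ inp
  ... | no  a≮y = record
    { decreasing = ∷-decreasing (swapTails-first-≤ (drop 1 a) b (first-drop-≤ (decreasing (a-partition inp)))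
                                                   (≤-trans (first-drop-≤ (b-decreasing inp)) (≮⇒≥ a≮y))
                                                   (Linked.tail (b-decreasing inp)))
                                (decreasing (swapTails-γ (SwapInput-step inp a≮y)))
    ; positive   = <⇒≤ (SwapInput-first inp a≮y) ∷ positive (swapTails-γ (SwapInput-step inp a≮y))
    ; bounded    = first-All z≤n (bounded (a-partition inp)) ∷ bounded (swapTails-γ (SwapInput-step inp a≮y))
    }

  swapTails-δ : ∀ {a b} → SwapInput d a b → BoundedPartition d (proj₂ (swapTails a b))
  swapTails-δ {b = []}      _   = record { decreasing = [] ; positive = [] ; bounded = [] }
  swapTails-δ {a} {y ∷ b} inp with first a <? y
  ... | yes a<y = exchange-δ inp a<y
  ... | no  a≮y = record
    { decreasing = ∷-decreasing (subst (_≤ y) (sym (swapTails-first-δ (drop 1 a) b))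
                                       (first-drop-≤ (b-decreasing inp)))
                                (decreasing (swapTails-δ (SwapInput-step inp a≮y)))
    ; positive   = All.head (b-positive inp) ∷ positive (swapTails-δ (SwapInput-step inp a≮y))
    ; bounded    = All.head (b-bounded inp) ∷ bounded (swapTails-δ (SwapInput-step inp a≮y))
    }

  unswapTails-swapTails : ∀ {a b} → SwapInput d a b → uncurry unswapTails (swapTails a b) ≡ (a , b)
  unswapTails-swapTails {b = []}      inp with () ← SwapInput-long inp
  unswapTails-swapTails {a} {y ∷ b} inp with first a <? y
  ... | yes _ = unswapTails-exchange inp
  unswapTails-swapTails {a} {y ∷ b} inp | no a≮y with first a <? y
  ...   | yes a<y = ⊥-elim (a≮y a<y)
  ...   | no  _   = trans (cong (Product.map (first a ∷_) (y ∷_)) (unswapTails-swapTails (SwapInput-step inp a≮y)))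
                          (cong (_, y ∷ b) (sym (nonempty-∷ a-nonempty)))
    where
    a-nonempty : 0 < length a
    a-nonempty = first-nonempty {a} (<⇒≤ (SwapInput-first inp a≮y))

record V3Shape (l : List ℕ) : Set where
  field
    alpha-∷ : alpha l ≡ durfee l ∷ drop 1 (alpha l)
    beta-∷  : beta l ≡ durfee l ∷ drop 1 (beta l)
    tails   : SwapInput (durfee l) (drop 1 (alpha l)) (drop 1 (beta l))

v3Shape : ∀ {n l} → IsPartitionOf n l → InV3 l → V3Shape l
v3Shape {l = l} part ((longer , β₁≡d) , α₁≡d , s≥2) = record
  { alpha-∷ = alpha-∷
  ; beta-∷  = beta-∷
  ; tails   = record
    { a-partition  = record
      { decreasing = drop-decreasing 1 (conj-decreasing positiveArms)
      ; positive   = All.drop⁺ 1 (conj-positive positiveArms)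
      ; bounded    = All.drop⁺ 1 (subst (λ m → All (_≤ m) α) α₁≡d (≤-head (conj-decreasing positiveArms)))
      }
    ; b-decreasing = drop-decreasing 1 dβ
    ; b-≥2         = All.drop⁺ 1 β≥2
    ; b-bounded    = All.drop⁺ 1 (subst (λ m → All (_≤ m) β) β₁≡d (≤-head dβ))
    ; longer       = ≤-pred (subst₂ (λ u v → length u + 2 ≤ length v) alpha-∷ beta-∷ longer)
    }
  }
  where
  d : ℕ
  d = durfee l
  α β positiveArms : List ℕ
  α = alpha l
  β = beta l
  positiveArms = filter (1 ≤?_) (arms l)
  dβ : Decreasing β
  dβ = drop-decreasing d (IsPartitionOf.decreasing part)
  β≥2 : All (2 ≤_) β
  β≥2 = ≤-smallest β s≥2
  β-nonempty : 0 < length β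
  β-nonempty = ≤-trans (s≤s z≤n) (≤-trans (m≤n+m 2 (length α)) longer)
  beta-∷ : β ≡ d ∷ drop 1 β
  beta-∷ = trans (nonempty-∷ β-nonempty) (cong (_∷ drop 1 β) β₁≡d)
  d≥2 : 2 ≤ d
  d≥2 = subst (2 ≤_) β₁≡d (All.head (subst (All (2 ≤_)) (nonempty-∷ β-nonempty) β≥2))
  alpha-∷ : α ≡ d ∷ drop 1 α
  alpha-∷ = trans (nonempty-∷ (first-nonempty {α} (subst (0 <_) (sym α₁≡d) (<⇒≤ d≥2))))
                  (cong (_∷ drop 1 α) α₁≡d)

swappedTails : List ℕ → List ℕ × List ℕ
swappedTails l = swapTails (drop 1 (alpha l)) (drop 1 (beta l))

vToU : List ℕ → List ℕ
vToU l = uncurry (fromSymbol (suc (durfee l))) (swappedTails l)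

square-step : ∀ {d s t u v} → s + t + 1 ≡ u + v → suc d * suc d + s + t ≡ d * d + (d + u) + (d + v)
square-step {d} {s} {t} {u} {v} eq = trans (expand d s t) (trans (cong (d * d + d + d +_) eq) (regroup d u v))
  where
  expand : ∀ d s t → suc d * suc d + s + t ≡ d * d + d + d + (s + t + 1)
  expand = solve-∀
  regroup : ∀ d u v → d * d + d + d + (u + v) ≡ d * d + (d + u) + (d + v)
  regroup = solve-∀

module _ {l : List ℕ} (shape : V3Shape l) where
  open V3Shape shape
  open BoundedPartition

  private
    d : ℕ
    d = durfee l
    γ δ : List ℕ
    γ = proj₁ (swappedTails l)
    δ = proj₂ (swappedTails l)

  vToU-γ : BoundedPartition (suc d) γ
  vToU-γ = BoundedPartition-suc (swapTails-γ tails)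

  vToU-δ₁ : first δ ≤ suc d
  vToU-δ₁ = m≤n⇒m≤1+n (first-All z≤n (bounded (swapTails-δ tails)))

  vToU-InU3 : InU3 (vToU l)
  vToU-InU3 = fromSymbol-InU3 (swapTails-γ tails) (swapTails-δ tails) (swapTails-length tails)

  vToU-isPartition : ∀ {n} → IsPartitionOf n l → IsPartitionOf n (vToU l)
  vToU-isPartition {n} part = subst (λ m → IsPartitionOf m (vToU l)) weight
    (fromSymbol-isPartition (decreasing vToU-γ) (bounded vToU-γ)
                            (decreasing (swapTails-δ tails)) (positive (swapTails-δ tails)) vToU-δ₁)
    where
    open ≡-Reasoning
    weight : suc d * suc d + sum γ + sum δ ≡ n
    weight = begin
      suc d * suc d + sum γ + sum δ
        ≡⟨ square-step {d} {sum γ} {sum δ} (swapTails-sum tails) ⟩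
      d * d + (d + sum (drop 1 (alpha l))) + (d + sum (drop 1 (beta l)))
        ≡⟨ cong₂ (λ u v → d * d + sum u + sum v) (sym alpha-∷) (sym beta-∷) ⟩
      d * d + sum (alpha l) + sum (beta l)
        ≡⟨ sym (sum-durfee (IsPartitionOf.decreasing part)) ⟩
      sum l
        ≡⟨ IsPartitionOf.sums part ⟩
      n ∎

vToU-injective : ∀ {l₁ l₂} → Decreasing l₁ → V3Shape l₁ → Decreasing l₂ → V3Shape l₂ →
                 vToU l₁ ≡ vToU l₂ → l₁ ≡ l₂
vToU-injective {l₁} {l₂} dl₁ s₁ dl₂ s₂ eq = durfeeSymbol-injective dl₁ dl₂ d≡ α≡ β≡
  where
  module S₁ = V3Shape s₁
  module S₂ = V3Shape s₂
  symbol≡ : suc (durfee l₁) ≡ suc (durfee l₂) × swappedTails l₁ ≡ swappedTails l₂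
  symbol≡ = fromSymbol-injective (vToU-γ s₁) (vToU-δ₁ s₁) (vToU-γ s₂) (vToU-δ₁ s₂) eq
  d≡ : durfee l₁ ≡ durfee l₂
  d≡ = suc-injective (proj₁ symbol≡)
  tails≡ : (drop 1 (alpha l₁) , drop 1 (beta l₁)) ≡ (drop 1 (alpha l₂) , drop 1 (beta l₂))
  tails≡ = trans (sym (unswapTails-swapTails S₁.tails))
                 (trans (cong (uncurry unswapTails) (proj₂ symbol≡)) (unswapTails-swapTails S₂.tails))
  α≡ : alpha l₁ ≡ alpha l₂
  α≡ = trans S₁.alpha-∷ (trans (cong₂ _∷_ d≡ (cong proj₁ tails≡)) (sym S₂.alpha-∷))
  β≡ : beta l₁ ≡ beta l₂
  β≡ = trans S₁.beta-∷ (trans (cong₂ _∷_ d≡ (cong proj₂ tails≡)) (sym S₂.beta-∷))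

lemma3p3 : (n : ℕ) → InjectionV3U3 n
lemma3p3 n = f , injective
  where
  f : V3 n → U3 n
  f (l , part , v3) = vToU l , vToU-isPartition (v3Shape part v3) part , vToU-InU3 (v3Shape part v3)
  injective : ∀ x y → proj₁ (f x) ≡ proj₁ (f y) → proj₁ x ≡ proj₁ y
  injective (l₁ , part₁ , v3₁) (l₂ , part₂ , v3₂) =
    vToU-injective (IsPartitionOf.decreasing part₁) (v3Shape part₁ v3₁)
                   (IsPartitionOf.decreasing part₂) (v3Shape part₂ v3₂)
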